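{- Let $\mathcal{C}$ be a category equipped with a stable proper factorisation system, and let $f\colon X\to Y$ be a pathwise embedding in $\mathcal{C}$. The following are equivalent: (1) $f$ is open; (2) for every commutative square $f\circ a=b\circ h$ with $P,Q$ paths and $h\colon P\to Q$, $a\colon P\to X$, $b\colon Q\to Y$ arbitrary morphisms, there exists $d\colon Q\to X$ with $d\circ h=a$ and $f\circ d=b$.
   Context: All categories are locally small and well-powered. Given morphisms $e,m$, say $e$ has the left lifting property with respect to $m$ if for every commutative square $v\circ e=m\circ u$ there is $d$ with $d\circ e=u$ and $m\circ d=v$. A weak factorisation system on a category is a pair $(\mathcal{Q},\mathcal{M})$ of classes of morphisms such that every morphism factors as $m\circ e$ with $e\in\mathcal{Q}$, $m\in\mathcal{M}$, $\mathcal{Q}$ is exactly the class of morphisms with the left lifting property with respect to all of $\mathcal{M}$, and $\mathcal{M}$ exactly the class with the right lifting property with respect to all of $\mathcal{Q}$. It is proper if morphisms of $\mathcal{Q}$ are epi and those of $\mathcal{M}$ mono; stable if moreover for any $e\in\mathcal{Q}$, $m\in\mathcal{M}$ with common codomain the pullback of $e$ along $m$ exists and lies in $\mathcal{Q}$. Morphisms in $\mathcal{M}$ are embeddings, those in $\mathcal{Q}$ quotients. $\mathrm{Emb}\,X$ is the set of embeddings into $X$ modulo $m\sim n$ iff $m=n\circ i$ for an isomorphism $i$. An object $P$ is a path if $\mathrm{Emb}\,P$ (ordered by $m\le n$ iff $m=n\circ i$ for some $i$) is a finite chain. A path embedding is an embedding whose domain is a path. A morphism $f\colon X\to Y$ is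 a pathwise embedding if $f\circ m$ is an embedding for every path embedding $m\colon P\to X$. A morphism $f\colon X\to Y$ is open if for every commutative square $f\circ m=n\circ s$ in which $P,Q$ are paths and $s\colon P\to Q$, $m\colon P\to X$, $n\colon Q\to Y$ are embeddings, there exists $d\colon Q\to X$ with $d\circ s=m$ and $f\circ d=n$. -}

module Defs where

open import Level using (Level; _⊔_; suc)
open import Data.Nat using (ℕ)
open import Data.Fin using (Fin)
open import Data.Product using (Σ; Σ-syntax; ∃; _×_; _,_)
open import Data.Sum using (_⊎_)
open import Relation.Binary.PropositionalEquality using (_≡_)

record Category (o ℓ : Level) : Set (suc (o ⊔ ℓ)) where
  infixr 9 _∘_
  field
    Obj  : Set o
    Hom  : Obj → Obj → Set ℓ
    id   : ∀ {A} → Hom A A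
    _∘_  : ∀ {A B C} → Hom B C → Hom A B → Hom A C
    identityˡ : ∀ {A B} {f : Hom A B} → id ∘ f ≡ f
    identityʳ : ∀ {A B} {f : Hom A B} → f ∘ id ≡ f
    assoc : ∀ {A B C D} {f : Hom A B} {g : Hom B C} {h : Hom C D} →
            (h ∘ g) ∘ f ≡ h ∘ (g ∘ f)

module _ {o ℓ : Level} (𝒞 : Category o ℓ) where
  open Category 𝒞

  MorClass : (p : Level) → Set (o ⊔ ℓ ⊔ suc p)
  MorClass p = ∀ {A B} → Hom A B → Set p

  IsEpi : ∀ {A B} → Hom A B → Set (o ⊔ ℓ)
  IsEpi {A} {B} e = ∀ {Z} (g h : Hom B Z) → g ∘ e ≡ h ∘ e → g ≡ h

  IsMono : ∀ {A B} → Hom A B → Set (o ⊔ ℓ)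
  IsMono {A} {B} m = ∀ {Z} (g h : Hom Z A) → m ∘ g ≡ m ∘ h → g ≡ h

  IsIso : ∀ {A B} → Hom A B → Set ℓ
  IsIso {A} {B} i = Σ[ j ∈ Hom B A ] (j ∘ i ≡ id × i ∘ j ≡ id)

  LLP : ∀ {A B C D} → Hom A B → Hom C D → Set ℓ
  LLP {A} {B} {C} {D} e m =
    (u : Hom A C) (v : Hom B D) → v ∘ e ≡ m ∘ u →
    Σ[ d ∈ Hom B C ] (d ∘ e ≡ u × m ∘ d ≡ v)

  IsPullback : ∀ {A B C P} (e : Hom A B) (m : Hom C B) (p : Hom P C) (q : Hom P A) →
               Set (o ⊔ ℓ)
  IsPullback {A} {B} {C} {P} e m p q =
    (m ∘ p ≡ e ∘ q) ×
    (∀ {Z} (x : Hom Z C) (y : Hom Z A) → m ∘ x ≡ e ∘ y →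
      Σ[ u ∈ Hom Z P ] ((p ∘ u ≡ x × q ∘ u ≡ y) ×
        (∀ (u' : Hom Z P) → p ∘ u' ≡ x → q ∘ u' ≡ y → u' ≡ u)))

  record IsWFS {p : Level} (𝒬 ℳ : MorClass p) : Set (o ⊔ ℓ ⊔ p) where
    field
      factor : ∀ {A B} (f : Hom A B) →
               Σ[ C ∈ Obj ] Σ[ e ∈ Hom A C ] Σ[ m ∈ Hom C B ]
                 (𝒬 e × ℳ m × f ≡ m ∘ e)
      𝒬-char : ∀ {A B} (e : Hom A B) →
               (𝒬 e → ∀ {C D} (m : Hom C D) → ℳ m → LLP e m) ×
               ((∀ {C D} (m : Hom C D) → ℳ m → LLP e m) → 𝒬 e)
      ℳ-char : ∀ {C D} (m : Hom C D) →
               (ℳ m → ∀ {A B} (e : Hom A B) → 𝒬 e → LLP e m) ×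
               ((∀ {A B} (e : Hom A B) → 𝒬 e → LLP e m) → ℳ m)

  record IsStableProperWFS {p : Level} (𝒬 ℳ : MorClass p) : Set (o ⊔ ℓ ⊔ p) where
    field
      wfs     : IsWFS 𝒬 ℳ
      𝒬-epi   : ∀ {A B} (e : Hom A B) → 𝒬 e → IsEpi e
      ℳ-mono  : ∀ {A B} (m : Hom A B) → ℳ m → IsMono m
      stable  : ∀ {A B C} (e : Hom A B) (m : Hom C B) → 𝒬 e → ℳ m →
                Σ[ P ∈ Obj ] Σ[ e' ∈ Hom P C ] Σ[ q ∈ Hom P A ]
                  (IsPullback e m e' q × 𝒬 e')

  module _ {p : Level} (ℳ : MorClass p) where

    -- elements of Emb X (before quotienting): embeddings into X
    Emb : Obj → Set (o ⊔ ℓ ⊔ p)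
    Emb X = Σ[ A ∈ Obj ] Σ[ m ∈ Hom A X ] ℳ m

    _≤E_ : ∀ {X} → Emb X → Emb X → Set ℓ
    (A , m , _) ≤E (B , n , _) = Σ[ i ∈ Hom A B ] (m ≡ n ∘ i)

    _∼E_ : ∀ {X} → Emb X → Emb X → Set ℓ
    (A , m , _) ∼E (B , n , _) = Σ[ i ∈ Hom A B ] (IsIso i × m ≡ n ∘ i)

    -- P is a path: Emb P (the quotient by ∼, ordered by ≤) is a finite chain.
    -- (≤ is automatically a partial order on the quotient since embeddings are mono.)
    -- Finiteness: finitely many ∼-classes; chain: any two elements comparable.
    IsPath : Obj → Set (o ⊔ ℓ ⊔ p)
    IsPath P =
      (Σ[ n ∈ ℕ ] Σ[ enum ∈ (Fin n → Emb P) ] (∀ (m : Emb P) → Σ[ k ∈ Fin n ] (m ∼E enum k)))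
      × (∀ (m n : Emb P) → (m ≤E n) ⊎ (n ≤E m))

    IsPathwiseEmbedding : ∀ {X Y} → Hom X Y → Set (o ⊔ ℓ ⊔ p)
    IsPathwiseEmbedding {X} {Y} f =
      ∀ {P} → IsPath P → (m : Hom P X) → ℳ m → ℳ (f ∘ m)

    IsOpen : ∀ {X Y} → Hom X Y → Set (o ⊔ ℓ ⊔ p)
    IsOpen {X} {Y} f =
      ∀ {P Q} → IsPath P → IsPath Q →
      (s : Hom P Q) (m : Hom P X) (n : Hom Q Y) → ℳ s → ℳ m → ℳ n →
      f ∘ m ≡ n ∘ s →
      Σ[ d ∈ Hom Q X ] (d ∘ s ≡ m × f ∘ d ≡ n)

    PathLifting : ∀ {X Y} → Hom X Y → Set (o ⊔ ℓ ⊔ p)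
    PathLifting {X} {Y} f =
      ∀ {P Q} → IsPath P → IsPath Q →
      (h : Hom P Q) (a : Hom P X) (b : Hom Q Y) →
      f ∘ a ≡ b ∘ h →
      Σ[ d ∈ Hom Q X ] (d ∘ h ≡ a × f ∘ d ≡ b)

-- An arbitrary lifting square f ∘ a = b ∘ h between paths P, Q is reduced to one between
-- embeddings: factor a = mₐ ∘ eₐ and b = m_b ∘ e_b, and lift eₐ against m_b to get
-- s : Pₐ → Q_b with m_b ∘ s = f ∘ mₐ. Since f is a pathwise embedding, f ∘ mₐ is an embedding,
-- hence so is s. The domains Pₐ and Q_b are paths, because a quotient of a path is a path:
-- pulling embeddings back along a stable quotient and taking images is order preserving and
-- recovers every embedding into the quotient. Openness now solves the square of embeddings,
-- and precomposing the solution with e_b solves the original square.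
module Submission where

open import Defs
open import Level using (Level; _⊔_)
open import Function.Bundles using (_⇔_; mk⇔)
open import Data.Product using (Σ-syntax; _,_; proj₁; proj₂)
open import Data.Fin using (Fin)
open import Data.Sum using (_⊎_)
import Data.Sum as Sum
open import Relation.Binary.PropositionalEquality
  using (_≡_; refl; sym; trans; cong; subst; module ≡-Reasoning)

module _ {o ℓ : Level} {𝒞 : Category o ℓ} where
  open Category 𝒞
  open ≡-Reasoning

  extendʳ : ∀ {B C D E} {a : Hom C D} {b : Hom B C} {c : Hom E D} {d : Hom B E} →
            a ∘ b ≡ c ∘ d → ∀ {Z} {x : Hom Z B} → a ∘ (b ∘ x) ≡ c ∘ (d ∘ x)
  extendʳ {a = a} {b} {c} {d} eq {x = x} = begin
    a ∘ (b ∘ x)  ≡⟨ sym assoc ⟩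
    (a ∘ b) ∘ x  ≡⟨ cong (_∘ x) eq ⟩
    (c ∘ d) ∘ x  ≡⟨ assoc ⟩
    c ∘ (d ∘ x)  ∎

  extendˡ : ∀ {B C D E} {a : Hom C D} {b : Hom B C} {c : Hom E D} {d : Hom B E} →
            a ∘ b ≡ c ∘ d → ∀ {Z} {x : Hom D Z} → (x ∘ a) ∘ b ≡ (x ∘ c) ∘ d
  extendˡ {a = a} {b} {c} {d} eq {x = x} = begin
    (x ∘ a) ∘ b  ≡⟨ assoc ⟩
    x ∘ (a ∘ b)  ≡⟨ cong (x ∘_) eq ⟩
    x ∘ (c ∘ d)  ≡⟨ sym assoc ⟩
    (x ∘ c) ∘ d  ∎

  IsPullback-jointly-monic : ∀ {A B C P Z} {e : Hom A B} {m : Hom C B} {p : Hom P C} {q : Hom P A} →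
                             IsPullback 𝒞 e m p q → {x y : Hom Z P} →
                             p ∘ x ≡ p ∘ y → q ∘ x ≡ q ∘ y → x ≡ y
  IsPullback-jointly-monic {p = p} {q} (commutes , universal) {x} {y} px≡py qx≡qy
    with universal (p ∘ x) (q ∘ x) (extendʳ commutes)
  ... | _ , _ , unique = trans (unique x refl refl) (sym (unique y (sym px≡py) (sym qx≡qy)))

  module _ {p : Level} {ℳ : MorClass 𝒞 p} where

    arrow : ∀ {X} (m : Emb 𝒞 ℳ X) → Hom (proj₁ m) X
    arrow (_ , m , _) = m

    PathLifting⇒IsOpen : ∀ {X Y} {f : Hom X Y} → PathLifting 𝒞 ℳ f → IsOpen 𝒞 ℳ f
    PathLifting⇒IsOpen lifting pathP pathQ s m n _ _ _ = lifting pathP pathQ s m n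

    ∼E⇒≤E : ∀ {X} {m n : Emb 𝒞 ℳ X} → _∼E_ 𝒞 ℳ m n → _≤E_ 𝒞 ℳ m n
    ∼E⇒≤E (i , _ , m≡ni) = i , m≡ni

    ∼E⇒≥E : ∀ {X} {m n : Emb 𝒞 ℳ X} → _∼E_ 𝒞 ℳ m n → _≤E_ 𝒞 ℳ n m
    ∼E⇒≥E {m = _ , m , _} {_ , n , _} (i , (j , _ , ij≡id) , m≡ni) = j , (begin
      n            ≡⟨ sym identityʳ ⟩
      n ∘ id       ≡⟨ cong (n ∘_) (sym ij≡id) ⟩
      n ∘ (i ∘ j)  ≡⟨ sym assoc ⟩
      (n ∘ i) ∘ j  ≡⟨ cong (_∘ j) (sym m≡ni) ⟩
      m ∘ j        ∎)

    ≤E-antisym : (∀ {A B} (m : Hom A B) → ℳ m → IsMono 𝒞 m) →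
                 ∀ {X} {m n : Emb 𝒞 ℳ X} → _≤E_ 𝒞 ℳ m n → _≤E_ 𝒞 ℳ n m → _∼E_ 𝒞 ℳ m n
    ≤E-antisym mono {m = _ , m , ℳm} {_ , n , ℳn} (i , m≡ni) (j , n≡mj) =
      i , (j , inverseˡ , inverseʳ) , m≡ni
      where
      inverseˡ : j ∘ i ≡ id
      inverseˡ = mono m ℳm (j ∘ i) id (begin
        m ∘ (j ∘ i)  ≡⟨ sym assoc ⟩
        (m ∘ j) ∘ i  ≡⟨ cong (_∘ i) (sym n≡mj) ⟩
        n ∘ i        ≡⟨ sym m≡ni ⟩
        m            ≡⟨ sym identityʳ ⟩
        m ∘ id       ∎)
      inverseʳ : i ∘ j ≡ id
      inverseʳ = mono n ℳn (i ∘ j) id (begin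
        n ∘ (i ∘ j)  ≡⟨ sym assoc ⟩
        (n ∘ i) ∘ j  ≡⟨ cong (_∘ j) (sym m≡ni) ⟩
        m ∘ j        ≡⟨ sym n≡mj ⟩
        n            ≡⟨ sym identityʳ ⟩
        n ∘ id       ∎)

    module WeakFactorisation {𝒬 : MorClass 𝒞 p} (wfs : IsWFS 𝒞 𝒬 ℳ) where
      open IsWFS wfs

      lift : ∀ {A B C D} {e : Hom A B} {m : Hom C D} → 𝒬 e → ℳ m → LLP 𝒞 e m
      lift {e = e} {m} 𝒬e ℳm = proj₁ (𝒬-char e) 𝒬e m ℳm

      ℳ-cancelˡ : ∀ {A B C} {n : Hom B C} {s : Hom A B} → IsMono 𝒞 n → ℳ (n ∘ s) → ℳ s
      ℳ-cancelˡ {n = n} {s} mono-n ℳns = proj₂ (ℳ-char s) λ g 𝒬g u v vg≡su →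
        let d , dg≡u , nsd≡nv = lift 𝒬g ℳns u (n ∘ v) (extendˡ vg≡su)
        in d , dg≡u , mono-n (s ∘ d) v (trans (sym assoc) nsd≡nv)

      ℳ-pullback : ∀ {A B C P} {e : Hom A B} {m : Hom C B} {p : Hom P C} {q : Hom P A} →
                   IsPullback 𝒞 e m p q → ℳ m → ℳ q
      ℳ-pullback {e = e} {m} {p} {q} pb@(commutes , universal) ℳm =
        proj₂ (ℳ-char q) λ g 𝒬g u v vg≡qu →
          let t , tg≡pu , mt≡ev = lift 𝒬g ℳm (p ∘ u) (e ∘ v) (begin
                (e ∘ v) ∘ g  ≡⟨ extendˡ vg≡qu ⟩
                (e ∘ q) ∘ u  ≡⟨ cong (_∘ u) (sym commutes) ⟩
                (m ∘ p) ∘ u  ≡⟨ assoc ⟩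
                m ∘ (p ∘ u)  ∎)
              w , (pw≡t , qw≡v) , _ = universal t v mt≡ev
          in w , IsPullback-jointly-monic pb
                   (trans (sym assoc) (trans (cong (_∘ g) pw≡t) tg≡pu))
                   (trans (sym assoc) (trans (cong (_∘ g) qw≡v) vg≡qu))
               , qw≡v

      record IsDirectImage {P P'} (e : Hom P P') (q : Emb 𝒞 ℳ P) (n : Emb 𝒞 ℳ P') : Set (ℓ ⊔ p) where
        constructor isDirectImage
        field
          quotient   : Hom (proj₁ q) (proj₁ n)
          𝒬-quotient : 𝒬 quotient
          commutes   : arrow n ∘ quotient ≡ e ∘ arrow q

      directImage : ∀ {P P'} (e : Hom P P') (q : Emb 𝒞 ℳ P) → Σ[ n ∈ Emb 𝒞 ℳ P' ] IsDirectImage e q n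
      directImage e (_ , q , _) with factor (e ∘ q)
      ... | C , e' , n , 𝒬e' , ℳn , eq≡ne' = (C , n , ℳn) , isDirectImage e' 𝒬e' (sym eq≡ne')

      IsDirectImage-least : ∀ {P P' C} {e : Hom P P'} {q : Emb 𝒞 ℳ P} {n : Emb 𝒞 ℳ P'} →
                            IsDirectImage e q n → {n' : Hom C P'} (ℳn' : ℳ n') {y : Hom (proj₁ q) C} →
                            e ∘ arrow q ≡ n' ∘ y → _≤E_ 𝒞 ℳ n (C , n' , ℳn')
      IsDirectImage-least {n = _ , n , _} (isDirectImage e' 𝒬e' ne'≡eq) ℳn' {y} eq≡n'y
        with lift 𝒬e' ℳn' y n (trans ne'≡eq eq≡n'y)
      ... | d , _ , n'd≡n = d , sym n'd≡n

      IsDirectImage-monotone : ∀ {P P'} {e : Hom P P'} {q q' : Emb 𝒞 ℳ P} {n n' : Emb 𝒞 ℳ P'} →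
                               IsDirectImage e q n → IsDirectImage e q' n' →
                               _≤E_ 𝒞 ℳ q q' → _≤E_ 𝒞 ℳ n n'
      IsDirectImage-monotone {e = e} {_ , q , _} {_ , q' , _} {n' = _ , n' , ℳn'}
                             image-q (isDirectImage e' _ n'e'≡eq') (i , q≡q'i) =
        IsDirectImage-least image-q ℳn' (begin
          e ∘ q          ≡⟨ cong (e ∘_) q≡q'i ⟩
          e ∘ (q' ∘ i)   ≡⟨ sym assoc ⟩
          (e ∘ q') ∘ i   ≡⟨ cong (_∘ i) (sym n'e'≡eq') ⟩
          (n' ∘ e') ∘ i  ≡⟨ assoc ⟩
          n' ∘ (e' ∘ i)  ∎)

    module _ {𝒬 : MorClass 𝒞 p} (S : IsStableProperWFS 𝒞 𝒬 ℳ) where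
      open IsStableProperWFS S
      open IsWFS wfs using (factor)
      open WeakFactorisation wfs

      preimage : ∀ {P P'} {e : Hom P P'} → 𝒬 e →
                 (n : Emb 𝒞 ℳ P') → Σ[ q ∈ Emb 𝒞 ℳ P ] IsDirectImage e q n
      preimage {e = e} 𝒬e (_ , n , ℳn) with stable e n 𝒬e ℳn
      ... | B , e' , q , pb@(commutes , _) , 𝒬e' = (B , q , ℳ-pullback pb ℳn) , isDirectImage e' 𝒬e' commutes

      IsPath-quotient : ∀ {P P'} {e : Hom P P'} → 𝒬 e → IsPath 𝒞 ℳ P → IsPath 𝒞 ℳ P'
      IsPath-quotient {P} {P'} {e} 𝒬e ((N , enum , covers) , chain) =
        (N , (λ k → push (enum k)) , covers') , chain'
        where
        push : Emb 𝒞 ℳ P → Emb 𝒞 ℳ P'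
        push q = proj₁ (directImage e q)

        push-image : (q : Emb 𝒞 ℳ P) → IsDirectImage e q (push q)
        push-image q = proj₂ (directImage e q)

        pull : Emb 𝒞 ℳ P' → Emb 𝒞 ℳ P
        pull n = proj₁ (preimage 𝒬e n)

        pull-image : (n : Emb 𝒞 ℳ P') → IsDirectImage e (pull n) n
        pull-image n = proj₂ (preimage 𝒬e n)

        covers' : (n : Emb 𝒞 ℳ P') → Σ[ k ∈ Fin N ] _∼E_ 𝒞 ℳ n (push (enum k))
        covers' n with covers (pull n)
        ... | k , pull-n∼enum-k =
          k , ≤E-antisym ℳ-mono {m = n} {n = push (enum k)}
                (IsDirectImage-monotone (pull-image n) (push-image (enum k))
                   (∼E⇒≤E {m = pull n} {n = enum k} pull-n∼enum-k))
                (IsDirectImage-monotone (push-image (enum k)) (pull-image n)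
                   (∼E⇒≥E {m = pull n} {n = enum k} pull-n∼enum-k))

        chain' : (n n' : Emb 𝒞 ℳ P') → _≤E_ 𝒞 ℳ n n' ⊎ _≤E_ 𝒞 ℳ n' n
        chain' n n' = Sum.map (IsDirectImage-monotone (pull-image n) (pull-image n'))
                              (IsDirectImage-monotone (pull-image n') (pull-image n))
                              (chain (pull n) (pull n'))

      IsOpen⇒PathLifting : ∀ {X Y} {f : Hom X Y} → IsPathwiseEmbedding 𝒞 ℳ f →
                           IsOpen 𝒞 ℳ f → PathLifting 𝒞 ℳ f
      IsOpen⇒PathLifting {f = f} pathwise isOpen pathP pathQ h a b fa≡bh =
        let _ , eₐ , mₐ , 𝒬eₐ , ℳmₐ , a≡mₐeₐ = factor a
            _ , e_b , m_b , 𝒬e_b , ℳm_b , b≡m_be_b = factor b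
            pathPₐ = IsPath-quotient 𝒬eₐ pathP
            s , seₐ≡e_bh , m_bs≡fmₐ = lift 𝒬eₐ ℳm_b (e_b ∘ h) (f ∘ mₐ) (begin
              (f ∘ mₐ) ∘ eₐ    ≡⟨ assoc ⟩
              f ∘ (mₐ ∘ eₐ)    ≡⟨ cong (f ∘_) (sym a≡mₐeₐ) ⟩
              f ∘ a            ≡⟨ fa≡bh ⟩
              b ∘ h            ≡⟨ cong (_∘ h) b≡m_be_b ⟩
              (m_b ∘ e_b) ∘ h  ≡⟨ assoc ⟩
              m_b ∘ (e_b ∘ h)  ∎)
            ℳs = ℳ-cancelˡ (ℳ-mono m_b ℳm_b) (subst ℳ (sym m_bs≡fmₐ) (pathwise pathPₐ mₐ ℳmₐ))
            d , ds≡mₐ , fd≡m_b =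
              isOpen pathPₐ (IsPath-quotient 𝒬e_b pathQ) s mₐ m_b ℳs ℳmₐ ℳm_b (sym m_bs≡fmₐ)
        in d ∘ e_b , (begin
             (d ∘ e_b) ∘ h  ≡⟨ assoc ⟩
             d ∘ (e_b ∘ h)  ≡⟨ cong (d ∘_) (sym seₐ≡e_bh) ⟩
             d ∘ (s ∘ eₐ)   ≡⟨ sym assoc ⟩
             (d ∘ s) ∘ eₐ   ≡⟨ cong (_∘ eₐ) ds≡mₐ ⟩
             mₐ ∘ eₐ        ≡⟨ sym a≡mₐeₐ ⟩
             a              ∎) , (begin
             f ∘ (d ∘ e_b)  ≡⟨ sym assoc ⟩
             (f ∘ d) ∘ e_b  ≡⟨ cong (_∘ e_b) fd≡m_b ⟩
             m_b ∘ e_b      ≡⟨ sym b≡m_be_b ⟩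
             b              ∎)

lemma4p1 : ∀ {o ℓ p : Level} (𝒞 : Category o ℓ) (𝒬 ℳ : MorClass 𝒞 p) →
           IsStableProperWFS 𝒞 𝒬 ℳ →
           ∀ {X Y} (f : Category.Hom 𝒞 X Y) →
           IsPathwiseEmbedding 𝒞 ℳ f →
           (IsOpen 𝒞 ℳ f ⇔ PathLifting 𝒞 ℳ f)
lemma4p1 𝒞 𝒬 ℳ S f pathwise = mk⇔ (IsOpen⇒PathLifting S pathwise) (PathLifting⇒IsOpen {𝒞 = 𝒞} {ℳ = ℳ})
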